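{- Let $\Pi$ be a mini-gringo program and let $p$ be a predicate occurring in $\Pi$. Then, for either choice of the order formula $\mathrm{Ord}$ (predicate version or level-mapping version), the formulas $\mathrm{OComp}^{\to}(p)$ and $\mathrm{OComp}_s^{\to}(p)$ are logically equivalent.
   Context: Mini-gringo programs: program terms are numerals $\overline n$, symbolic constants, program variables, $\mathit{inf}$, $\mathit{sup}$, $|t|$ and $(t_1\circ t_2)$ with $\circ\in\{+,-,\times,/,\backslash,..\}$. An atom is $p(\mathbf t)$; a literal is an atom preceded by zero, one or two $\mathit{not}$; a comparison is $t_1\prec t_2$ with $\prec\in\{=,\neq,<,>,\le,\ge\}$. A rule is $\mathit{Head}\leftarrow\mathit{Body}$, $\mathit{Body}$ a possibly empty conjunction $B_1\wedge\dots\wedge B_n$ of literals and comparisons, $\mathit{Head}$ an atom $p(\mathbf t)$ (basic rule), $\{p(\mathbf t)\}$ (choice rule) or empty (constraint); a program is a finite set of rules. For a rule $R$: $\mathrm{Body}(R)$ its body; $B^+(R)$ the set of un-negated atoms of its body; $\mathrm{HeadLit}(R)=p(\mathbf t)$ if the head is $p(\mathbf t)$ or $\{p(\mathbf t)\}$. Formulas are in a two-sorted first-order language (sorts general and its subsort integer) with arithmetic $|\cdot|,+,-,\times$ on integers and comparisons. $\mathrm{val}_t(V)$ is a formula expressing that $V$ is a value of the term $t$: $V=t$ if $t$ is precomputed or a variable; $\exists I(\mathrm{val}_{t_1}(I)\wedge V=|I|)$ for $|t_1|$; $\exists I,J(\mathrm{val}_{t_1}(I)\wedge\mathrm{val}_{t_2}(J)\wedge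 V=I\circ J)$ for $\circ\in\{+,-,\times\}$; for $t_1/t_2$: $\exists I,J,K(\mathrm{val}_{t_1}(I)\wedge\mathrm{val}_{t_2}(J)\wedge K\times|J|\le|I|<(K+\overline1)\times|J|\wedge((I\times J\ge\overline0\wedge V=K)\vee(I\times J<\overline0\wedge V=-K)))$; for $t_1\backslash t_2$ the same with $V=I-K\times J$ and $V=I+K\times J$; for $t_1..t_2$: $\exists I,J,K(\mathrm{val}_{t_1}(I)\wedge\mathrm{val}_{t_2}(J)\wedge I\le K\le J\wedge V=K)$; $I,J,K$ fresh integer variables; tuples give conjunctions. $\tau^B(q(\mathbf t))=\exists\mathbf V(\mathrm{val}_{\mathbf t}(\mathbf V)\wedge q(\mathbf V))$; $\tau^B(\mathit{not}\,q(\mathbf t))$ and $\tau^B(\mathit{not}\,\mathit{not}\,q(\mathbf t))$ likewise with $\neg q(\mathbf V)$, $\neg\neg q(\mathbf V)$; $\tau^B(t_1\prec t_2)=\exists V_1V_2(\mathrm{val}_{t_1}(V_1)\wedge\mathrm{val}_{t_2}(V_2)\wedge V_1\prec V_2)$; $\tau^B(B_1\wedge\dots\wedge B_n)=\tau^B(B_1)\wedge\dots\wedge\tau^B(B_n)$. Order formula: $\mathrm{Ord}(q(\mathbf Z),p(\mathbf X))$ is either $\mathbf Z<_{qp}\mathbf X$ for new predicate symbols $<_{qp}$ (predicate version), or $\mathrm{lvl}_q(\mathbf Z)<\mathrm{lvl}_p(\mathbf X)$ for new integer-valued function symbols $\mathrm{lvl}_q,\mathrm{lvl}_p$ (level-mapping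 version). For a basic or choice rule $R$ with head atom $p(\mathbf t)$ and fresh program variables $\mathbf X$: $\mathrm{Form}(R,\mathbf X)=\mathrm{val}_{\mathbf t}(\mathbf X)\wedge\tau^B(\mathrm{Body}(R))$ (basic) resp. $\mathrm{val}_{\mathbf t}(\mathbf X)\wedge\tau^B(\mathrm{Body}(R))\wedge\neg\neg p(\mathbf X)$ (choice); $\mathrm{OForm}(R,\mathbf X)$ is defined identically but with $\tau^B_<$ in place of $\tau^B$, where $\tau^B_<(B_1\wedge\dots\wedge B_n)=\tau^B_<(B_1)\wedge\dots\wedge\tau^B_<(B_n)$, $\tau^B_<(q(\mathbf t))=\exists\mathbf V(\mathrm{val}_{\mathbf t}(\mathbf V)\wedge q(\mathbf V)\wedge\mathrm{Ord}(q(\mathbf V),p(\mathbf X)))$ for an atom $q(\mathbf t)$, and $\tau^B_<(B_i)=\tau^B(B_i)$ for all other $B_i$. With $\mathbf Y$ the free variables of $\mathrm{Form}(R,\mathbf X)$ other than $\mathbf X$ and $\mathbf Z$ fresh variables of the arity of $q$: $\mathrm{OComp}^{\to}(p)=\forall\mathbf X\big(p(\mathbf X)\to\bigvee_{R\in\Pi,\mathrm{HeadLit}(R)=p(\mathbf t)}\exists\mathbf Y(\mathrm{Form}(R,\mathbf X)\wedge\bigwedge_{q(\mathbf t')\in B^+(R)}\exists\mathbf Z(\mathrm{val}_{\mathbf t'}(\mathbf Z)\wedge q(\mathbf Z)\wedge\mathrm{Ord}(q(\mathbf Z),p(\mathbf X))))\big)$, $\mathrm{OComp}_s^{\to}(p)=\forall\mathbf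 X\big(p(\mathbf X)\to\bigvee_{R\in\Pi,\mathrm{HeadLit}(R)=p(\mathbf t)}\exists\mathbf Y\,\mathrm{OForm}(R,\mathbf X)\big)$. -}

module Defs where

open import Data.Nat using (ℕ; _≟_)
open import Data.Integer using (ℤ)
open import Data.Bool using (if_then_else_)
open import Data.List using (List; []; _∷_; _++_)
open import Data.List.Relation.Unary.All using (All)
open import Data.List.Relation.Unary.Any using (Any)
open import Data.Vec using (Vec; []; _∷_)
open import Data.Product using (Σ; _×_; _,_)
open import Data.Sum using (_⊎_)
open import Data.Unit using (⊤)
open import Data.Maybe using (Maybe; just; nothing)
open import Relation.Nullary using (¬_; does)
open import Relation.Binary.PropositionalEquality using (_≡_)

Var : Set
Var = ℕ

Sym : Set
Sym = ℕ

record PredSym : Set where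
  constructor _/_
  field
    name  : ℕ
    arity : ℕ
open PredSym public

data BinOp : Set where
  plusO minusO timesO divO modO intervalO : BinOp

data Term : Set where
  numeral  : ℤ → Term
  symConst : Sym → Term
  var      : Var → Term
  infT     : Term
  supT     : Term
  absT     : Term → Term
  binT     : BinOp → Term → Term → Term

data Cmp : Set where
  eqC neqC ltC gtC leC geC : Cmp

data Sign : Set where
  noNot oneNot twoNot : Sign

data BodyElem : Set where
  lit  : Sign → (q : PredSym) → Vec Term (arity q) → BodyElem
  comp : Cmp → Term → Term → BodyElem

Body : Set
Body = List BodyElem

data Head : Set where
  basicH  : (p : PredSym) → Vec Term (arity p) → Head
  choiceH : (p : PredSym) → Vec Term (arity p) → Head
  emptyH  : Head

record Rule : Set where
  constructor _←_
  field
    head : Head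
    body : Body
open Rule public

Program : Set
Program = List Rule

data HeadKind : Set where
  basicK choiceK : HeadKind

headLit : Head → Maybe (Σ HeadKind λ _ → Σ PredSym λ p → Vec Term (arity p))
headLit (basicH p t)  = just (basicK , p , t)
headLit (choiceH p t) = just (choiceK , p , t)
headLit emptyH        = nothing

posAtoms : Body → List (Σ PredSym λ q → Vec Term (arity q))
posAtoms []                     = []
posAtoms (lit noNot q t ∷ bs)   = (q , t) ∷ posAtoms bs
posAtoms (lit oneNot q t ∷ bs)  = posAtoms bs
posAtoms (lit twoNot q t ∷ bs)  = posAtoms bs
posAtoms (comp _ _ _ ∷ bs)      = posAtoms bs

termVars : Term → List Var
termVars (numeral _)    = []
termVars (symConst _)   = []
termVars (var x)        = x ∷ []
termVars infT           = []
termVars supT           = []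
termVars (absT t)       = termVars t
termVars (binT _ t u)   = termVars t ++ termVars u

termsVars : ∀ {n} → Vec Term n → List Var
termsVars []       = []
termsVars (t ∷ ts) = termVars t ++ termsVars ts

bodyElemVars : BodyElem → List Var
bodyElemVars (lit _ _ t)  = termsVars t
bodyElemVars (comp _ t u) = termVars t ++ termVars u

bodyVars : Body → List Var
bodyVars []       = []
bodyVars (b ∷ bs) = bodyElemVars b ++ bodyVars bs

headVars : Head → List Var
headVars (basicH _ t)  = termsVars t
headVars (choiceH _ t) = termsVars t
headVars emptyH        = []

ruleVars : Rule → List Var
ruleVars R = headVars (head R) ++ bodyVars (body R)

data OccursInElem (p : PredSym) : BodyElem → Set where
  here : ∀ s t → OccursInElem p (lit s p t)

data OccursInHead (p : PredSym) : Head → Set where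
  inBasic  : ∀ t → OccursInHead p (basicH p t)
  inChoice : ∀ t → OccursInHead p (choiceH p t)

OccursInRule : PredSym → Rule → Set
OccursInRule p R = OccursInHead p (head R) ⊎ Any (OccursInElem p) (body R)

OccursIn : PredSym → Program → Set
OccursIn p Π = Any (OccursInRule p) Π

-- Interpretations of the two-sorted target language
-- (sorts general and its subsort integer; the integer universe is
--  embedded into the general universe by the injection ι)

record Interp : Set₁ where
  field
    D     : Set
    Int   : Set
    ι     : Int → D
    ι-inj : ∀ {i j} → ι i ≡ ι j → i ≡ j
    numI  : ℤ → Int
    symI  : Sym → D
    infI  : D
    supI  : D
    absI  : Int → Int
    _+I_  : Int → Int → Int
    _-I_  : Int → Int → Int
    _*I_  : Int → Int → Int
    negI  : Int → Int
    _<D_  : D → D → Set       -- comparison predicates (= is identity, ≠ its negation)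
    _>D_  : D → D → Set
    _≤D_  : D → D → Set
    _≥D_  : D → D → Set
    pred  : (p : PredSym) → Vec D (arity p) → Set
    ordPred : (q p : PredSym) → Vec D (arity q) → Vec D (arity p) → Set
    lvl     : (p : PredSym) → Vec D (arity p) → Int

data OrdVersion : Set where
  predicateVersion levelVersion : OrdVersion

module Semantics (I : Interp) where
  open Interp I

  Env : Set
  Env = Var → D

  _[_↦_] : Env → Var → D → Env
  (σ [ x ↦ d ]) y = if does (y ≟ x) then d else σ y

  ∃vars : List Var → (Env → Set) → Env → Set
  ∃vars []       φ σ = φ σ
  ∃vars (y ∷ ys) φ σ = Σ D λ d → ∃vars ys φ (σ [ y ↦ d ])

  cmpSem : Cmp → D → D → Set
  cmpSem eqC  a b = a ≡ b
  cmpSem neqC a b = ¬ (a ≡ b)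
  cmpSem ltC  a b = a <D b
  cmpSem gtC  a b = a >D b
  cmpSem leC  a b = a ≤D b
  cmpSem geC  a b = a ≥D b

  val : Term → Env → D → Set
  val (numeral n)  σ v = v ≡ ι (numI n)
  val (symConst c) σ v = v ≡ symI c
  val (var x)      σ v = v ≡ σ x
  val infT         σ v = v ≡ infI
  val supT         σ v = v ≡ supI
  val (absT t)     σ v = Σ Int λ i → val t σ (ι i) × v ≡ ι (absI i)
  val (binT plusO t₁ t₂)  σ v =
    Σ Int λ i → Σ Int λ j → val t₁ σ (ι i) × val t₂ σ (ι j) × v ≡ ι (i +I j)
  val (binT minusO t₁ t₂) σ v =
    Σ Int λ i → Σ Int λ j → val t₁ σ (ι i) × val t₂ σ (ι j) × v ≡ ι (i -I j)
  val (binT timesO t₁ t₂) σ v =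
    Σ Int λ i → Σ Int λ j → val t₁ σ (ι i) × val t₂ σ (ι j) × v ≡ ι (i *I j)
  val (binT divO t₁ t₂) σ v =
    Σ Int λ i → Σ Int λ j → Σ Int λ k →
      val t₁ σ (ι i) × val t₂ σ (ι j)
      × ι (k *I absI j) ≤D ι (absI i)
      × ι (absI i) <D ι ((k +I numI (ℤ.pos 1)) *I absI j)
      × ((ι (i *I j) ≥D ι (numI (ℤ.pos 0)) × v ≡ ι k)
         ⊎ (ι (i *I j) <D ι (numI (ℤ.pos 0)) × v ≡ ι (negI k)))
  val (binT modO t₁ t₂) σ v =
    Σ Int λ i → Σ Int λ j → Σ Int λ k →
      val t₁ σ (ι i) × val t₂ σ (ι j)
      × ι (k *I absI j) ≤D ι (absI i)
      × ι (absI i) <D ι ((k +I numI (ℤ.pos 1)) *I absI j)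
      × ((ι (i *I j) ≥D ι (numI (ℤ.pos 0)) × v ≡ ι (i -I (k *I j)))
         ⊎ (ι (i *I j) <D ι (numI (ℤ.pos 0)) × v ≡ ι (i +I (k *I j))))
  val (binT intervalO t₁ t₂) σ v =
    Σ Int λ i → Σ Int λ j → Σ Int λ k →
      val t₁ σ (ι i) × val t₂ σ (ι j)
      × ι i ≤D ι k × ι k ≤D ι j × v ≡ ι k

  vals : ∀ {n} → Vec Term n → Env → Vec D n → Set
  vals []       σ []       = ⊤
  vals (t ∷ ts) σ (v ∷ vs) = val t σ v × vals ts σ vs

  Ord : OrdVersion → (q : PredSym) → Vec D (arity q) → (p : PredSym) → Vec D (arity p) → Set
  Ord predicateVersion q Z p X = ordPred q p Z X
  Ord levelVersion     q Z p X = ι (lvl q Z) <D ι (lvl p X)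

  τB : BodyElem → Env → Set
  τB (lit noNot q t)  σ = Σ (Vec D (arity q)) λ V → vals t σ V × pred q V
  τB (lit oneNot q t) σ = Σ (Vec D (arity q)) λ V → vals t σ V × ¬ pred q V
  τB (lit twoNot q t) σ = Σ (Vec D (arity q)) λ V → vals t σ V × ¬ ¬ pred q V
  τB (comp ≺ t₁ t₂)   σ = Σ D λ V₁ → Σ D λ V₂ → val t₁ σ V₁ × val t₂ σ V₂ × cmpSem ≺ V₁ V₂

  τBody : Body → Env → Set
  τBody B σ = All (λ b → τB b σ) B

  τB< : OrdVersion → (p : PredSym) → Vec D (arity p) → BodyElem → Env → Set
  τB< o p X (lit noNot q t) σ =
    Σ (Vec D (arity q)) λ V → vals t σ V × pred q V × Ord o q V p X
  τB< o p X b σ = τB b σ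

  τBody< : OrdVersion → (p : PredSym) → Vec D (arity p) → Body → Env → Set
  τBody< o p X B σ = All (λ b → τB< o p X b σ) B

  choicePart : HeadKind → (p : PredSym) → Vec D (arity p) → Set
  choicePart basicK  p X = ⊤
  choicePart choiceK p X = ¬ ¬ pred p X

  Form : HeadKind → (p : PredSym) → Vec Term (arity p) → Body → Vec D (arity p) → Env → Set
  Form k p t B X σ = vals t σ X × τBody B σ × choicePart k p X

  OForm : OrdVersion → HeadKind → (p : PredSym) → Vec Term (arity p) → Body → Vec D (arity p) → Env → Set
  OForm o k p t B X σ = vals t σ X × τBody< o p X B σ × choicePart k p X

  OrdAtoms : OrdVersion → (p : PredSym) → Vec D (arity p) → Body → Env → Set
  OrdAtoms o p X B σ =
    All (λ { (q , t′) → Σ (Vec D (arity q)) λ Z → vals t′ σ Z × pred q Z × Ord o q Z p X })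
        (posAtoms B)

  HasHead : Rule → HeadKind → (p : PredSym) → Vec Term (arity p) → Set
  HasHead R k p t = headLit (head R) ≡ just (k , p , t)

  OComp→ : OrdVersion → Program → PredSym → Env → Set
  OComp→ o Π p σ =
    (X : Vec D (arity p)) → pred p X →
      Any (λ R → Σ HeadKind λ k → Σ (Vec Term (arity p)) λ t → HasHead R k p t ×
             ∃vars (ruleVars R)
               (λ σ′ → Form k p t (body R) X σ′ × OrdAtoms o p X (body R) σ′) σ)
          Π

  OComps→ : OrdVersion → Program → PredSym → Env → Set
  OComps→ o Π p σ =
    (X : Vec D (arity p)) → pred p X →
      Any (λ R → Σ HeadKind λ k → Σ (Vec Term (arity p)) λ t → HasHead R k p t ×
             ∃vars (ruleVars R) (OForm o k p t (body R) X) σ)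
          Π

{-# OPTIONS --safe #-}
-- OForm(R, X) differs from Form(R, X) only in that every positive body atom q(t′) is
-- strengthened to ∃V (val_t′(V) ∧ q(V) ∧ Ord(q(V), p(X))).  These are exactly the
-- conjuncts that OComp→(p) adds for q(t′) ∈ B⁺(R), so τᴮ_<(Body(R)) is equivalent to
-- τᴮ(Body(R)) conjoined with them, and equivalence is preserved under ∃Y and ⋁_R.
module Submission where

open import Defs
open import Data.List using ([]; _∷_)
open import Data.List.Relation.Unary.All using ([]; _∷_)
import Data.List.Relation.Unary.Any as Any
open import Data.Product using (_×_; _,_)
open import Data.Vec using (Vec)
open import Function.Bundles using (_⇔_; mk⇔; module Equivalence)

open Equivalence using (to; from)

module _ (I : Interp) where
  open Interp I
  open Semantics I

  ∃vars-map : ∀ ys {φ ψ : Env → Set} → (∀ {σ} → φ σ → ψ σ) → ∀ {σ} → ∃vars ys φ σ → ∃vars ys ψ σ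
  ∃vars-map []       φ⇒ψ φσ       = φ⇒ψ φσ
  ∃vars-map (y ∷ ys) φ⇒ψ (d , φσ) = d , ∃vars-map ys φ⇒ψ φσ

  ∃vars-cong : ∀ ys {φ ψ : Env → Set} → (∀ {σ} → φ σ ⇔ ψ σ) → ∀ {σ} → ∃vars ys φ σ ⇔ ∃vars ys ψ σ
  ∃vars-cong ys φ⇔ψ = mk⇔ (∃vars-map ys (to φ⇔ψ)) (∃vars-map ys (from φ⇔ψ))

  module _ (o : OrdVersion) (p : PredSym) (X : Vec D (arity p)) where

    τBody<⇒τBody : ∀ B {σ} → τBody< o p X B σ → τBody B σ
    τBody<⇒τBody []                   []                        = []
    τBody<⇒τBody (lit noNot  _ _ ∷ B) ((V , tV , qV , _) ∷ bs) = (V , tV , qV) ∷ τBody<⇒τBody B bs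
    τBody<⇒τBody (lit oneNot _ _ ∷ B) (b ∷ bs)                 = b ∷ τBody<⇒τBody B bs
    τBody<⇒τBody (lit twoNot _ _ ∷ B) (b ∷ bs)                 = b ∷ τBody<⇒τBody B bs
    τBody<⇒τBody (comp _ _ _     ∷ B) (b ∷ bs)                 = b ∷ τBody<⇒τBody B bs

    τBody<⇒OrdAtoms : ∀ B {σ} → τBody< o p X B σ → OrdAtoms o p X B σ
    τBody<⇒OrdAtoms []                   []       = []
    τBody<⇒OrdAtoms (lit noNot  _ _ ∷ B) (b ∷ bs) = b ∷ τBody<⇒OrdAtoms B bs
    τBody<⇒OrdAtoms (lit oneNot _ _ ∷ B) (_ ∷ bs) = τBody<⇒OrdAtoms B bs
    τBody<⇒OrdAtoms (lit twoNot _ _ ∷ B) (_ ∷ bs) = τBody<⇒OrdAtoms B bs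
    τBody<⇒OrdAtoms (comp _ _ _     ∷ B) (_ ∷ bs) = τBody<⇒OrdAtoms B bs

    τBody×OrdAtoms⇒τBody< : ∀ B {σ} → τBody B σ → OrdAtoms o p X B σ → τBody< o p X B σ
    τBody×OrdAtoms⇒τBody< []                   []       []       = []
    τBody×OrdAtoms⇒τBody< (lit noNot  _ _ ∷ B) (_ ∷ bs) (a ∷ as) = a ∷ τBody×OrdAtoms⇒τBody< B bs as
    τBody×OrdAtoms⇒τBody< (lit oneNot _ _ ∷ B) (b ∷ bs) as       = b ∷ τBody×OrdAtoms⇒τBody< B bs as
    τBody×OrdAtoms⇒τBody< (lit twoNot _ _ ∷ B) (b ∷ bs) as       = b ∷ τBody×OrdAtoms⇒τBody< B bs as
    τBody×OrdAtoms⇒τBody< (comp _ _ _     ∷ B) (b ∷ bs) as       = b ∷ τBody×OrdAtoms⇒τBody< B bs as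

    OForm⇔Form×OrdAtoms : ∀ k t B {σ} → OForm o k p t B X σ ⇔ (Form k p t B X σ × OrdAtoms o p X B σ)
    OForm⇔Form×OrdAtoms k t B = mk⇔
      (λ (tX , τb< , choice) → (tX , τBody<⇒τBody B τb< , choice) , τBody<⇒OrdAtoms B τb<)
      (λ ((tX , τb , choice) , ords) → tX , τBody×OrdAtoms⇒τBody< B τb ords , choice)

  OComp→⇔OComps→ : ∀ o Π p σ → OComp→ o Π p σ ⇔ OComps→ o Π p σ
  OComp→⇔OComps→ o Π p σ = mk⇔
    (λ hyp X pX → Any.map (λ { {R} (k , t , hR , e) → k , t , hR , from (disjunct⇔ X R k t) e }) (hyp X pX))
    (λ hyp X pX → Any.map (λ { {R} (k , t , hR , e) → k , t , hR , to   (disjunct⇔ X R k t) e }) (hyp X pX))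
    where
    disjunct⇔ : ∀ X R k t → ∃vars (ruleVars R) (OForm o k p t (body R) X) σ ⇔
                       ∃vars (ruleVars R) (λ σ′ → Form k p t (body R) X σ′ × OrdAtoms o p X (body R) σ′) σ
    disjunct⇔ X R k t = ∃vars-cong (ruleVars R) (OForm⇔Form×OrdAtoms o p X k t (body R))

mainTheorem4 : (Π : Program) (p : PredSym) → OccursIn p Π → (o : OrdVersion) → (I : Interp) → (σ : Semantics.Env I) → Semantics.OComp→ I o Π p σ ⇔ Semantics.OComps→ I o Π p σ
mainTheorem4 Π p _ o I σ = OComp→⇔OComps→ I o Π p σ
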